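{- Let $\Omega_T$ be the infinite triangular lattice graph (equivalently, vertex set $\mathbb{Z}^2$ with $(a,b)$ adjacent to $(a\pm1,b)$, $(a,b\pm1)$, $(a+1,b+1)$ and $(a-1,b-1)$; it is $6$-regular). Then $\chi_{td}(\Omega_T)=12$.
   Context: For a (possibly infinite) graph $G$ and a positive integer $k$, a proper $k$-total difference labeling of $G$ is a function $f$ from $V(G)\cup E(G)$ to $\{1,2,\dots,k\}$ such that: (1) for every edge $\{u,v\}$, $f(\{u,v\})=|f(u)-f(v)|$; (2) adjacent vertices receive different labels; (3) two edges sharing a vertex receive different labels; (4) no edge receives the same label as one of its endpoints. $\chi_{td}(G)$ denotes the smallest $k$ for which $G$ has a proper $k$-total difference labeling. -}

module Defs where

open import Data.Nat using (ℕ; _≤_; _<_; ∣_-_∣)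
open import Data.Integer as ℤ using (ℤ; +_; -[1+_])
open import Data.Product using (_×_; Σ; _,_; proj₁; proj₂)
open import Data.Sum using (_⊎_)
open import Relation.Nullary using (¬_)
open import Relation.Binary.PropositionalEquality using (_≡_; _≢_)

-- A (possibly infinite) graph, given by a vertex type and an adjacency relation.
-- (The only graph used below, Ω_T, has a symmetric irreflexive adjacency.)
record Graph : Set₁ where
  field
    V    : Set
    Adj  : V → V → Set
open Graph public

-- Proper k-total difference labeling. The labeling on V ∪ E is determined by
-- the vertex labels f together with condition (1): f({u,v}) = |f(u) - f(v)|.
record IsProperTDL (G : Graph) (k : ℕ) (f : V G → ℕ) : Set where
  field
    vrange : ∀ v → 1 ≤ f v × f v ≤ k
    erange : ∀ u v → Adj G u v → 1 ≤ ∣ f u - f v ∣ × ∣ f u - f v ∣ ≤ k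
    vproper : ∀ u v → Adj G u v → f u ≢ f v
    eproper : ∀ v u w → Adj G v u → Adj G v w → u ≢ w →
              ∣ f v - f u ∣ ≢ ∣ f v - f w ∣
    incident : ∀ u v → Adj G u v → ∣ f u - f v ∣ ≢ f u × ∣ f u - f v ∣ ≢ f v

HasTDL : Graph → ℕ → Set
HasTDL G k = Σ (V G → ℕ) (IsProperTDL G k)

χtd≡ : Graph → ℕ → Set
χtd≡ G m = HasTDL G m × (∀ k → HasTDL G k → m ≤ k)

TriStep : ℤ × ℤ → Set
TriStep d = (d ≡ (+ 1 , + 0)) ⊎ (d ≡ (-[1+ 0 ] , + 0))
          ⊎ (d ≡ (+ 0 , + 1)) ⊎ (d ≡ (+ 0 , -[1+ 0 ]))
          ⊎ (d ≡ (+ 1 , + 1)) ⊎ (d ≡ (-[1+ 0 ] , -[1+ 0 ]))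

TriAdj : ℤ × ℤ → ℤ × ℤ → Set
TriAdj (a , b) (c , d) = TriStep (c ℤ.- a , d ℤ.- b)

ΩT : Graph
ΩT = record { V = ℤ × ℤ ; Adj = TriAdj }

-- A vertex of Ω_T with label x sees six neighbours, and its six edge labels
-- ∣x - y∣ must be distinct differences to labels y compatible with x. So every
-- label x used by a proper labeling has at least six such differences inside
-- the set of used labels. Starting from {0, …, 11} and repeatedly discarding
-- labels without six differences empties the set after five rounds, so at
-- least 12 labels are needed. Conversely, labeling (a , b) by a function of
-- (a + 2b) mod 9 works, since along the six edges a + 2b changes by ±1, ±2,
-- ±3; this reduces properness to a check on the nine residues.
module Submission where

open import Defs

open import Data.Nat as ℕ using (ℕ; zero; suc; _≤_; _<_; s≤s; _≤?_; ∣_-_∣; _≟_)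
import Data.Nat.Properties as ℕ
open import Data.Nat.GeneralisedArithmetic using (fold)
open import Data.Nat.DivMod using (_mod_)
open import Data.Integer as ℤ using (ℤ; +_; -[1+_]; 1ℤ; -1ℤ)
import Data.Integer.Properties as ℤ
open import Data.Integer.Tactic.RingSolver using (solve-∀)
open import Data.Fin as Fin using (Fin; toℕ)
open import Data.Fin.Properties as Fin using (all?; injective⇒≤)
open import Data.Vec using (_∷_; []; lookup)
open import Data.List as List using (List; []; _∷_; filter; map; deduplicate; length; upTo)
open import Data.List.Membership.Propositional using (_∈_)
open import Data.List.Membership.Propositional.Properties
  using (∈-filter⁺; ∈-map⁺; ∈-deduplicate⁺; ∈-upTo⁺)
open import Data.List.Relation.Unary.Any using (index)
open import Data.List.Relation.Unary.Any.Properties using (lookup-index)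
open import Data.Product using (_×_; _,_; proj₁; proj₂; ∃-syntax)
import Data.Product.Properties as Product
open import Data.Sum using (inj₁; inj₂)
open import Function using (_∘_; Injective)
open import Relation.Nullary using (Dec; yes; no; contradiction)
open import Relation.Nullary.Decidable
  using (from-yes; map′; ¬?; _×-dec_; _→-dec_; decidable-stable)
open import Relation.Binary.PropositionalEquality
  using (_≡_; _≢_; refl; sym; trans; cong; cong₂; subst; module ≡-Reasoning)

record PortNumbering (G : Graph) (d : ℕ) : Set where
  field
    nbr     : V G → Fin d → V G
    nbr-adj : ∀ v i → Adj G v (nbr v i)
    nbr-inj : ∀ v → Injective _≡_ _≡_ (nbr v)
    adj-nbr : ∀ {u w} → Adj G u w → ∃[ i ] w ≡ nbr u i

Compatible : ℕ → ℕ → Set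
Compatible x y = x ≢ y × ∣ x - y ∣ ≢ x × ∣ x - y ∣ ≢ y

compatible? : ∀ x y → Dec (Compatible x y)
compatible? x y = ¬? (x ≟ y) ×-dec ¬? (∣ x - y ∣ ≟ x) ×-dec ¬? (∣ x - y ∣ ≟ y)

ProperEdge : ℕ → ℕ → ℕ → Set
ProperEdge k x y = (1 ≤ ∣ x - y ∣ × ∣ x - y ∣ ≤ k) × Compatible x y

properEdge? : ∀ k x y → Dec (ProperEdge k x y)
properEdge? k x y = ((1 ≤? ∣ x - y ∣) ×-dec (∣ x - y ∣ ≤? k)) ×-dec compatible? x y

record ProperStar (k x : ℕ) {d : ℕ} (y : Fin d → ℕ) : Set where
  field
    centre-range   : 1 ≤ x × x ≤ k
    edges          : ∀ i → ProperEdge k x (y i)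
    edge-injective : Injective _≡_ _≡_ (λ i → ∣ x - y i ∣)

properStar? : ∀ k x {d} (y : Fin d → ℕ) → Dec (ProperStar k x y)
properStar? k x y = map′
  (λ (r , e , inj) → record
    { centre-range = r ; edges = e ; edge-injective = λ {i} {j} → inj i j })
  (λ star → let open ProperStar star in
    centre-range , edges , λ i j → edge-injective)
  ((1 ≤? x ×-dec x ≤? k) ×-dec all? (properEdge? k x ∘ y)
    ×-dec all? λ i → all? λ j → (∣ x - y i ∣ ≟ ∣ x - y j ∣) →-dec (i Fin.≟ j))

properStar-resp : ∀ {k x d} {y y′ : Fin d → ℕ} →
                  (∀ i → y i ≡ y′ i) → ProperStar k x y → ProperStar k x y′
properStar-resp {k} {x} {y = y} {y′} y≗y′ star = record
  { centre-range   = centre-range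
  ; edges          = λ i → subst (ProperEdge k x) (y≗y′ i) (edges i)
  ; edge-injective = λ {i} {j} eq → edge-injective (trans (edge≗ i) (trans eq (sym (edge≗ j))))
  }
  where
  open ProperStar star
  edge≗ : ∀ i → ∣ x - y i ∣ ≡ ∣ x - y′ i ∣
  edge≗ i = cong (λ z → ∣ x - z ∣) (y≗y′ i)

module _ {G : Graph} {d : ℕ} (P : PortNumbering G d) where
  open PortNumbering P

  properTDL⇒properStar : ∀ {k f} → IsProperTDL G k f → ∀ v → ProperStar k (f v) (f ∘ nbr v)
  properTDL⇒properStar {f = f} proper v = record
    { centre-range   = vrange v
    ; edges          = λ i → erange v _ (nbr-adj v i) , vproper v _ (nbr-adj v i) , incident v _ (nbr-adj v i)
    ; edge-injective = λ {i} {j} eq → decidable-stable (i Fin.≟ j)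
        λ i≢j → eproper v _ _ (nbr-adj v i) (nbr-adj v j) (i≢j ∘ nbr-inj v) eq
    }
    where open IsProperTDL proper

  properStar⇒properTDL : ∀ {k f} → (∀ v → ProperStar k (f v) (f ∘ nbr v)) → IsProperTDL G k f
  properStar⇒properTDL {k} {f} star = record
    { vrange   = λ v → ProperStar.centre-range (star v)
    ; erange   = λ u w u~w → proj₁ (edge u w u~w)
    ; vproper  = λ u w u~w → proj₁ (proj₂ (edge u w u~w))
    ; eproper  = eproper
    ; incident = λ u w u~w → proj₂ (proj₂ (edge u w u~w))
    }
    where
    edge : ∀ u w → Adj G u w → ProperEdge k (f u) (f w)
    edge u w u~w with i , refl ← adj-nbr u~w = ProperStar.edges (star u) i

    eproper : ∀ v u w → Adj G v u → Adj G v w → u ≢ w → ∣ f v - f u ∣ ≢ ∣ f v - f w ∣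
    eproper v u w v~u v~w u≢w eq with i , refl ← adj-nbr v~u | j , refl ← adj-nbr v~w =
      u≢w (cong (nbr v) (ProperStar.edge-injective (star v) eq))

  equivariant⇒properTDL : ∀ {k} {A : Set} (c : V G → A) (move : Fin d → A → A) (t : A → ℕ) →
                          (∀ v i → c (nbr v i) ≡ move i (c v)) →
                          (∀ r → ProperStar k (t r) (λ i → t (move i r))) →
                          IsProperTDL G k (t ∘ c)
  equivariant⇒properTDL c move t c-equivariant local = properStar⇒properTDL λ v →
    properStar-resp (λ i → cong t (sym (c-equivariant v i))) (local (c v))

injection⇒≤length : ∀ {A : Set} {d} {xs : List A} {g : Fin d → A} →
                    Injective _≡_ _≡_ g → (∀ i → g i ∈ xs) → d ≤ length xs
injection⇒≤length {xs = xs} {g} g-inj g∈xs = injective⇒≤ λ {i} {j} same-index → g-inj (begin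
  g i                             ≡⟨ lookup-index (g∈xs i) ⟩
  List.lookup xs (index (g∈xs i)) ≡⟨ cong (List.lookup xs) same-index ⟩
  List.lookup xs (index (g∈xs j)) ≡⟨ lookup-index (g∈xs j) ⟨
  g j                             ∎)
  where open ≡-Reasoning

differences : List ℕ → ℕ → List ℕ
differences S x = deduplicate _≟_ (map (λ y → ∣ x - y ∣) (filter (compatible? x) S))

prune : ℕ → List ℕ → List ℕ
prune d S = filter (λ x → d ≤? length (differences S x)) S

properStar⇒∈prune : ∀ {k x d S} {y : Fin d → ℕ} →
                    ProperStar k x y → x ∈ S → (∀ i → y i ∈ S) → x ∈ prune d S
properStar⇒∈prune {x = x} {d} {S} {y} star x∈S y∈S =
  ∈-filter⁺ (λ x → d ≤? length (differences S x)) x∈S (injection⇒≤length edge-injective edge∈)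
  where
  open ProperStar star
  edge∈ : ∀ i → ∣ x - y i ∣ ∈ differences S x
  edge∈ i = ∈-deduplicate⁺ _≟_ (∈-map⁺ (λ y → ∣ x - y ∣)
              (∈-filter⁺ (compatible? x) (y∈S i) (proj₂ (edges i))))

module _ {G : Graph} {d : ℕ} (P : PortNumbering G d) where
  open PortNumbering P

  labels∈prune : ∀ {k f S} → IsProperTDL G k f → (∀ v → f v ∈ S) → ∀ v → f v ∈ prune d S
  labels∈prune proper f∈S v =
    properStar⇒∈prune (properTDL⇒properStar P proper v) (f∈S v) (f∈S ∘ nbr v)

  labels∈iterated-prune : ∀ {k f S} → IsProperTDL G k f → (∀ v → f v ∈ S) →
                          ∀ n v → f v ∈ fold S (prune d) n
  labels∈iterated-prune proper f∈S zero    = f∈S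
  labels∈iterated-prune proper f∈S (suc n) = labels∈prune proper (labels∈iterated-prune proper f∈S n)

  pruned-away⇒χtd> : V G → ∀ m n → fold (upTo (suc m)) (prune d) n ≡ [] →
                     ∀ k → HasTDL G k → m < k
  pruned-away⇒χtd> v₀ m n pruned-away k (f , proper) with m ℕ.<? k
  ... | yes m<k = m<k
  ... | no  m≮k = contradiction
          (subst (f v₀ ∈_) pruned-away (labels∈iterated-prune proper f<m+1 n v₀)) λ ()
    where
    f<m+1 : ∀ v → f v ∈ upTo (suc m)
    f<m+1 v = ∈-upTo⁺ (s≤s (ℕ.≤-trans (proj₂ (IsProperTDL.vrange proper v)) (ℕ.≮⇒≥ m≮k)))

_⊕_ : ℤ × ℤ → ℤ × ℤ → ℤ × ℤ
(a , b) ⊕ (c , d) = a ℤ.+ c , b ℤ.+ d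

_⊖_ : ℤ × ℤ → ℤ × ℤ → ℤ × ℤ
(c , d) ⊖ (a , b) = c ℤ.- a , d ℤ.- b

⊕-⊖-cancel : ∀ v s → (v ⊕ s) ⊖ v ≡ s
⊕-⊖-cancel (a , b) (c , d) = cong₂ _,_ ([a+c]-a≡c a c) ([a+c]-a≡c b d)
  where
  [a+c]-a≡c : ∀ a c → (a ℤ.+ c) ℤ.- a ≡ c
  [a+c]-a≡c = solve-∀

⊖-⊕-cancel : ∀ u w → u ⊕ (w ⊖ u) ≡ w
⊖-⊕-cancel (a , b) (c , d) = cong₂ _,_ (a+[c-a]≡c a c) (a+[c-a]≡c b d)
  where
  a+[c-a]≡c : ∀ a c → a ℤ.+ (c ℤ.- a) ≡ c
  a+[c-a]≡c = solve-∀

triStep : Fin 6 → ℤ × ℤ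
triStep = lookup ((+ 1 , + 0) ∷ (-1ℤ , + 0) ∷ (+ 0 , + 1) ∷ (+ 0 , -1ℤ) ∷ (+ 1 , + 1) ∷ (-1ℤ , -1ℤ) ∷ [])

TriStep-triStep : ∀ i → TriStep (triStep i)
TriStep-triStep Fin.zero = inj₁ refl
TriStep-triStep (Fin.suc Fin.zero) = inj₂ (inj₁ refl)
TriStep-triStep (Fin.suc (Fin.suc Fin.zero)) = inj₂ (inj₂ (inj₁ refl))
TriStep-triStep (Fin.suc (Fin.suc (Fin.suc Fin.zero))) = inj₂ (inj₂ (inj₂ (inj₁ refl)))
TriStep-triStep (Fin.suc (Fin.suc (Fin.suc (Fin.suc Fin.zero)))) = inj₂ (inj₂ (inj₂ (inj₂ (inj₁ refl))))
TriStep-triStep (Fin.suc (Fin.suc (Fin.suc (Fin.suc (Fin.suc Fin.zero))))) = inj₂ (inj₂ (inj₂ (inj₂ (inj₂ refl))))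

TriStep⇒triStep : ∀ {s} → TriStep s → ∃[ i ] triStep i ≡ s
TriStep⇒triStep (inj₁ refl)                               = Fin.# 0 , refl
TriStep⇒triStep (inj₂ (inj₁ refl))                        = Fin.# 1 , refl
TriStep⇒triStep (inj₂ (inj₂ (inj₁ refl)))                 = Fin.# 2 , refl
TriStep⇒triStep (inj₂ (inj₂ (inj₂ (inj₁ refl))))          = Fin.# 3 , refl
TriStep⇒triStep (inj₂ (inj₂ (inj₂ (inj₂ (inj₁ refl)))))   = Fin.# 4 , refl
TriStep⇒triStep (inj₂ (inj₂ (inj₂ (inj₂ (inj₂ refl)))))   = Fin.# 5 , refl

triStep-injective : Injective _≡_ _≡_ triStep
triStep-injective {i} {j} = from-yes
  (all? λ i → all? λ j → Product.≡-dec ℤ._≟_ ℤ._≟_ (triStep i) (triStep j) →-dec (i Fin.≟ j)) i j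

ΩT-ports : PortNumbering ΩT 6
ΩT-ports = record
  { nbr     = λ v i → v ⊕ triStep i
  ; nbr-adj = λ v i → subst TriStep (sym (⊕-⊖-cancel v (triStep i))) (TriStep-triStep i)
  ; nbr-inj = λ v {i} {j} eq → triStep-injective (begin
      triStep i                 ≡⟨ ⊕-⊖-cancel v (triStep i) ⟨
      (v ⊕ triStep i) ⊖ v       ≡⟨ cong (_⊖ v) eq ⟩
      (v ⊕ triStep j) ⊖ v       ≡⟨ ⊕-⊖-cancel v (triStep j) ⟩
      triStep j                 ∎)
  ; adj-nbr = λ {u} {w} u~w → let i , i↦w-u = TriStep⇒triStep u~w in
      i , trans (sym (⊖-⊕-cancel u w)) (cong (u ⊕_) (sym i↦w-u))
  }
  where open ≡-Reasoning

module ℤAction {A : Set} (next prev : A → A)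
               (prev-next : ∀ x → prev (next x) ≡ x) (next-prev : ∀ x → next (prev x) ≡ x) where

  act : ℤ → A → A
  act (+ n)    x = fold x next n
  act -[1+ n ] x = fold (prev x) prev n

  act-suc : ∀ z x → act (z ℤ.+ 1ℤ) x ≡ next (act z x)
  act-suc (+ n)          x = cong (fold x next) (ℕ.+-comm n 1)
  act-suc -[1+ zero ]    x = sym (next-prev x)
  act-suc -[1+ suc n ]   x = sym (next-prev _)

  act-pred : ∀ z x → act (z ℤ.- 1ℤ) x ≡ prev (act z x)
  act-pred z x = begin
    act (z ℤ.- 1ℤ) x                    ≡⟨ prev-next _ ⟨
    prev (next (act (z ℤ.- 1ℤ) x))      ≡⟨ cong prev (act-suc (z ℤ.- 1ℤ) x) ⟨
    prev (act (z ℤ.- 1ℤ ℤ.+ 1ℤ) x)      ≡⟨ cong (λ u → prev (act u x)) (z-1+1≡z z) ⟩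
    prev (act z x)                      ∎
    where
    open ≡-Reasoning
    z-1+1≡z : ∀ z → z ℤ.- 1ℤ ℤ.+ 1ℤ ≡ z
    z-1+1≡z = solve-∀

  private
    +-rotate : ∀ z w u → z ℤ.+ (u ℤ.+ w) ≡ z ℤ.+ w ℤ.+ u
    +-rotate = solve-∀

  act-+ : ∀ z w x → act (z ℤ.+ w) x ≡ act w (act z x)
  act-+ z (+ zero)     x = cong (λ u → act u x) (ℤ.+-identityʳ z)
  act-+ z (+ suc n)    x = begin
    act (z ℤ.+ (1ℤ ℤ.+ + n)) x          ≡⟨ cong (λ u → act u x) (+-rotate z (+ n) 1ℤ) ⟩
    act (z ℤ.+ + n ℤ.+ 1ℤ) x            ≡⟨ act-suc (z ℤ.+ + n) x ⟩
    next (act (z ℤ.+ + n) x)            ≡⟨ cong next (act-+ z (+ n) x) ⟩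
    next (act (+ n) (act z x))          ∎
    where open ≡-Reasoning
  act-+ z -[1+ zero ]  x = act-pred z x
  act-+ z -[1+ suc n ] x = begin
    act (z ℤ.+ (-1ℤ ℤ.+ -[1+ n ])) x    ≡⟨ cong (λ u → act u x) (+-rotate z -[1+ n ] -1ℤ) ⟩
    act (z ℤ.+ -[1+ n ] ℤ.- 1ℤ) x       ≡⟨ act-pred (z ℤ.+ -[1+ n ]) x ⟩
    prev (act (z ℤ.+ -[1+ n ]) x)       ≡⟨ cong prev (act-+ z -[1+ n ] x) ⟩
    prev (act -[1+ n ] (act z x))       ∎
    where open ≡-Reasoning

next₉ prev₉ : Fin 9 → Fin 9
next₉ r = suc (toℕ r) mod 9
prev₉ r = (toℕ r ℕ.+ 8) mod 9

prev₉-next₉ : ∀ r → prev₉ (next₉ r) ≡ r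
prev₉-next₉ = from-yes (all? λ r → prev₉ (next₉ r) Fin.≟ r)

next₉-prev₉ : ∀ r → next₉ (prev₉ r) ≡ r
next₉-prev₉ = from-yes (all? λ r → next₉ (prev₉ r) Fin.≟ r)

open ℤAction next₉ prev₉ prev₉-next₉ next₉-prev₉

slope : ℤ × ℤ → ℤ
slope (a , b) = a ℤ.+ (b ℤ.+ b)

slope-⊕ : ∀ v s → slope (v ⊕ s) ≡ slope v ℤ.+ slope s
slope-⊕ (a , b) (c , d) = linear a b c d
  where
  linear : ∀ a b c d → a ℤ.+ c ℤ.+ (b ℤ.+ d ℤ.+ (b ℤ.+ d)) ≡ a ℤ.+ (b ℤ.+ b) ℤ.+ (c ℤ.+ (d ℤ.+ d))
  linear = solve-∀

-- (a + 2b) mod 9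
residue : ℤ × ℤ → Fin 9
residue v = act (slope v) Fin.zero

residue-⊕ : ∀ v s → residue (v ⊕ s) ≡ act (slope s) (residue v)
residue-⊕ v s = trans (cong (λ z → act z Fin.zero) (slope-⊕ v s)) (act-+ (slope v) (slope s) Fin.zero)

labelOfResidue : Fin 9 → ℕ
labelOfResidue = lookup (1 ∷ 3 ∷ 12 ∷ 11 ∷ 8 ∷ 2 ∷ 7 ∷ 10 ∷ 9 ∷ [])

triangularLabeling : ℤ × ℤ → ℕ
triangularLabeling = labelOfResidue ∘ residue

triangularLabeling-proper : IsProperTDL ΩT 12 triangularLabeling
triangularLabeling-proper =
  equivariant⇒properTDL ΩT-ports residue move labelOfResidue (λ v i → residue-⊕ v (triStep i))
    (from-yes (all? λ r → properStar? 12 (labelOfResidue r) (λ i → labelOfResidue (move i r))))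
  where
  move : Fin 6 → Fin 9 → Fin 9
  move i = act (slope (triStep i))

-- Pruning {0, …, 11} for degree 6 gives {1, 2, 3, 4, 7, 8, 9, 10, 11},
-- {1, 2, 3, 7, 8, 9, 10, 11}, {1, 2, 3, 7, 8, 10, 11}, {3, 8, 10, 11}, [].
mainTheorem4 : χtd≡ ΩT 12
mainTheorem4 =
    (triangularLabeling , triangularLabeling-proper)
  , pruned-away⇒χtd> ΩT-ports (+ 0 , + 0) 11 5 refl
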